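{- Let $G$ be a finite abelian group with a subgroup $H$, and let $a,b$ be positive integers. Suppose there exists an IMRS$^*_{G\setminus H}(a,b;|G\setminus H|/(ab))$. If there exists an MRS$^*_H(a,b;|H|/(ab))$, then there exists an MRS$^*_G(a,b;|G|/(ab))$.
   Context: For a finite abelian group $(K,+)$ and a subset $T\subseteq K$ with $|T|=xyz$, an IMRS$^*_{T}(x,y;z)$ (for $T=K\setminus S$ with $S$ a union of subgroups) is a collection of $z$ arrays of size $x\times y$ whose entries are elements of $T$, each element of $T$ appearing exactly once among all the arrays, such that every row sum and every column sum in every array equals $0\in K$. An MRS$^*_K(x,y;z)$ is the same notion with $T=K$ (so $|K|=xyz$). -}

module Defs where

open import Level using (Level; _⊔_)
open import Algebra.Bundles using (AbelianGroup)
open import Data.Nat using (ℕ; zero; suc)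
open import Data.Fin using (Fin; zero; suc)
open import Data.Product using (Σ; ∃; _×_; _,_)
open import Data.Unit.Polymorphic using (⊤)
open import Relation.Nullary using (¬_)
open import Relation.Unary using (Pred)
open import Function.Bundles using (Inverse)
open import Relation.Binary.PropositionalEquality as ≡ using (_≡_)

module _ {c ℓ : Level} (G : AbelianGroup c ℓ) where
  open AbelianGroup G renaming (Carrier to K)

  IsFinite : Set (c ⊔ ℓ)
  IsFinite = Σ ℕ λ n → Inverse (≡.setoid (Fin n)) setoid

  record IsSubgroup {ℓ′ : Level} (H : Pred K ℓ′) : Set (c ⊔ ℓ ⊔ ℓ′) where
    field
      resp  : ∀ {x y} → x ≈ y → H x → H y
      ε∈    : H ε
      ∙∈    : ∀ {x y} → H x → H y → H (x ∙ y)
      ⁻¹∈   : ∀ {x} → H x → H (x ⁻¹)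

  Sum : (n : ℕ) → (Fin n → K) → K
  Sum zero    f = ε
  Sum (suc n) f = f zero ∙ Sum n (λ i → f (suc i))

  Arrays : ℕ → ℕ → ℕ → Set c
  Arrays x y z = Fin z → Fin x → Fin y → K

  record IsMRSOn {ℓ′ : Level} (T : Pred K ℓ′) (x y z : ℕ) (A : Arrays x y z)
         : Set (c ⊔ ℓ ⊔ ℓ′) where
    field
      entries∈ : ∀ k i j → T (A k i j)
      injective : ∀ k i j k′ i′ j′ → A k i j ≈ A k′ i′ j′ →
                  (k ≡ k′) × (i ≡ i′) × (j ≡ j′)
      covers   : ∀ g → T g → ∃ λ k → ∃ λ i → ∃ λ j → A k i j ≈ g
      rowSums  : ∀ k i → Sum y (λ j → A k i j) ≈ ε
      colSums  : ∀ k j → Sum x (λ i → A k i j) ≈ ε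

  MRSOn : {ℓ′ : Level} → Pred K ℓ′ → ℕ → ℕ → ℕ → Set (c ⊔ ℓ ⊔ ℓ′)
  MRSOn T x y z = Σ (Arrays x y z) (IsMRSOn T x y z)

  MRS* : ℕ → ℕ → ℕ → Set (c ⊔ ℓ)
  MRS* = MRSOn {ℓ′ = c} (λ _ → ⊤)

  -- MRS*_H(x,y;z) for a subgroup H (sums in H are sums in G).
  MRS*-sub : {ℓ′ : Level} → Pred K ℓ′ → ℕ → ℕ → ℕ → Set (c ⊔ ℓ ⊔ ℓ′)
  MRS*-sub H = MRSOn H

  IMRS*-compl : {ℓ′ : Level} → Pred K ℓ′ → ℕ → ℕ → ℕ → Set (c ⊔ ℓ ⊔ ℓ′)
  IMRS*-compl H = MRSOn (λ g → ¬ H g)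

-- Concatenating the arrays of an IMRS* on G ∖ H with those of an MRS* on H
-- keeps all row and column sums zero and uses every element of G exactly
-- once: G ∖ H and H are disjoint, and an element occurring in neither family
-- would lie neither in H nor outside it.  Constructively this last step needs
-- a search through the entries, hence decidable equality, which finiteness of
-- G provides.
module Submission where

open import Defs
open import Level using (Level)
open import Algebra.Bundles using (AbelianGroup)
open import Data.Nat using (ℕ; _≤_; _+_)
open import Data.Fin using (Fin; splitAt; _↑ˡ_; _↑ʳ_)
open import Data.Fin.Properties using (any?; inj⇒≟; splitAt⁻¹-↑ˡ; splitAt⁻¹-↑ʳ)
open import Data.Vec.Functional using (_++_)
open import Data.Vec.Functional.Properties using (lookup-++ˡ; lookup-++ʳ)
open import Data.Vec.Functional.Relation.Unary.All.Properties using (++⁺)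
open import Data.Product using (∃; _×_; _,_)
open import Data.Sum using (inj₁; inj₂)
open import Data.Unit.Polymorphic using (tt)
open import Function.Properties.Inverse using (Inverse⇒Injection)
open import Function.Construct.Symmetry using (inverse)
open import Relation.Binary.Definitions using (Decidable; _Respects_)
open import Relation.Nullary using (¬_; Dec; yes; no; contradiction)
open import Relation.Unary using (Pred; ∁; _∪_; _⊥_)
open import Relation.Binary.PropositionalEquality as ≡ using (_≡_)

module _ {c ℓ : Level} (G : AbelianGroup c ℓ) where
  open AbelianGroup G using (_≈_; ε; sym; trans; reflexive) renaming (Carrier to K)

  finite⇒≈-decidable : IsFinite G → Decidable _≈_
  finite⇒≈-decidable (_ , Fin↔K) = inj⇒≟ (Inverse⇒Injection (inverse Fin↔K))

  entry? : Decidable _≈_ → {x y z : ℕ} (A : Arrays G x y z) (g : K) →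
           Dec (∃ λ k → ∃ λ i → ∃ λ j → A k i j ≈ g)
  entry? _≈?_ A g = any? λ k → any? λ i → any? λ j → A k i j ≈? g

  module _ {ℓ₁ ℓ₂ : Level} {T₁ : Pred K ℓ₁} {T₂ : Pred K ℓ₂}
           (T₂-resp : T₂ Respects _≈_) (T₁⊥T₂ : T₁ ⊥ T₂) {x y z₁ z₂ : ℕ} where

    MRSOn-++ : MRSOn G T₁ x y z₁ → MRSOn G T₂ x y z₂ →
               MRSOn G (T₁ ∪ T₂) x y (z₁ + z₂)
    MRSOn-++ (A₁ , M₁) (A₂ , M₂) = A₁ ++ A₂ , record
      { entries∈  = both (λ B → ∀ i j → (T₁ ∪ T₂) (B i j))
                         (λ k i j → inj₁ (M₁.entries∈ k i j))
                         (λ k i j → inj₂ (M₂.entries∈ k i j))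
      ; injective = injective
      ; covers    = covers
      ; rowSums   = both (λ B → ∀ i → Sum G y (B i) ≈ ε) M₁.rowSums M₂.rowSums
      ; colSums   = both (λ B → ∀ j → Sum G x (λ i → B i j) ≈ ε) M₁.colSums M₂.colSums
      }
      where
      module M₁ = IsMRSOn M₁
      module M₂ = IsMRSOn M₂
      A = A₁ ++ A₂

      both : ∀ {p} (P : Pred (Fin x → Fin y → K) p) →
             (∀ k → P (A₁ k)) → (∀ k → P (A₂ k)) → ∀ k → P (A k)
      both P = ++⁺ P {xs = A₁} {ys = A₂}

      disjoint : ∀ k i j k′ i′ j′ → ¬ (A₁ k i j ≈ A₂ k′ i′ j′)
      disjoint k i j k′ i′ j′ e =
        T₁⊥T₂ (M₁.entries∈ k i j , T₂-resp (sym e) (M₂.entries∈ k′ i′ j′))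

      injective : ∀ k i j k′ i′ j′ → A k i j ≈ A k′ i′ j′ →
                  (k ≡ k′) × (i ≡ i′) × (j ≡ j′)
      injective k i j k′ i′ j′ e
        with splitAt z₁ k in p | splitAt z₁ k′ in p′
      ... | inj₁ l | inj₁ l′ with M₁.injective l i j l′ i′ j′ e
      ...   | ≡.refl , i≡i′ , j≡j′ =
                ≡.trans (≡.sym (splitAt⁻¹-↑ˡ p)) (splitAt⁻¹-↑ˡ p′) , i≡i′ , j≡j′
      injective k i j k′ i′ j′ e
          | inj₂ l | inj₂ l′ with M₂.injective l i j l′ i′ j′ e
      ...   | ≡.refl , i≡i′ , j≡j′ =
                ≡.trans (≡.sym (splitAt⁻¹-↑ʳ p)) (splitAt⁻¹-↑ʳ p′) , i≡i′ , j≡j′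
      injective k i j k′ i′ j′ e
          | inj₁ l | inj₂ l′ = contradiction e (disjoint l i j l′ i′ j′)
      injective k i j k′ i′ j′ e
          | inj₂ l | inj₁ l′ = contradiction (sym e) (disjoint l′ i′ j′ l i j)

      covers : ∀ g → (T₁ ∪ T₂) g → ∃ λ k → ∃ λ i → ∃ λ j → A k i j ≈ g
      covers g (inj₁ t) with M₁.covers g t
      ... | l , i , j , e =
            l ↑ˡ z₂ , i , j , trans (reflexive (≡.cong (λ B → B i j) (lookup-++ˡ A₁ A₂ l))) e
      covers g (inj₂ t) with M₂.covers g t
      ... | l , i , j , e =
            z₁ ↑ʳ l , i , j , trans (reflexive (≡.cong (λ B → B i j) (lookup-++ʳ A₁ A₂ l))) e

  MRSOn⇒MRS* : {ℓ′ : Level} {T : Pred K ℓ′} → Decidable _≈_ → (∀ g → ¬ ¬ T g) →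
               {x y z : ℕ} → MRSOn G T x y z → MRS* G x y z
  MRSOn⇒MRS* {T = T} _≈?_ ¬¬T (A , M) = A , record
    { entries∈  = λ _ _ _ → tt
    ; injective = injective
    ; covers    = λ g _ → covers g
    ; rowSums   = rowSums
    ; colSums   = colSums
    }
    where
    open IsMRSOn M using (injective; rowSums; colSums)

    covers : ∀ g → ∃ λ k → ∃ λ i → ∃ λ j → A k i j ≈ g
    covers g with entry? _≈?_ A g
    ... | yes hit = hit
    ... | no ¬hit = contradiction (λ t → ¬hit (IsMRSOn.covers M g t)) (¬¬T g)

mainTheorem7 : {c ℓ ℓ′ : Level} (G : AbelianGroup c ℓ) → IsFinite G →
    (H : Pred (AbelianGroup.Carrier G) ℓ′) → IsSubgroup G H →
    (a b : ℕ) → 1 ≤ a → 1 ≤ b →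
    (z₁ : ℕ) → IMRS*-compl G H a b z₁ →
    (z₂ : ℕ) → MRS*-sub G H a b z₂ →
    ∃ λ z → MRS* G a b z
mainTheorem7 G finite H H≤G a b _ _ z₁ M₁ z₂ M₂ =
  z₁ + z₂ , MRSOn⇒MRS* G (finite⇒≈-decidable G finite) ¬¬-∁H∪H
                         (MRSOn-++ G (IsSubgroup.resp H≤G) ∁H⊥H M₁ M₂)
  where
  ∁H⊥H : ∁ H ⊥ H
  ∁H⊥H (h∉H , h∈H) = h∉H h∈H

  ¬¬-∁H∪H : ∀ g → ¬ ¬ (∁ H ∪ H) g
  ¬¬-∁H∪H g ¬∁H∪H = ¬∁H∪H (inj₁ λ h → ¬∁H∪H (inj₂ h))
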